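{- There are uncountably many distinct locating-paired-dominating sets of the king grid with density $2/9$.
   Context: The king grid is the infinite graph $G=(V,E)$ with $V=\mathbb{Z}\times\mathbb{Z}$, two distinct vertices being adjacent iff their Euclidean distance is at most $\sqrt2$. $N(v)$ is the open neighborhood of $v$ and $N[v]=N(v)\cup\{v\}$. A set $S\subset V$ is a locating-paired-dominating set (LPDS) if (i) every vertex $v\in V$ satisfies $N[v]\cap S\neq\emptyset$, (ii) the induced subgraph $G[S]$ has a perfect matching, and (iii) for any distinct $u,v\in V\setminus S$, $N(u)\cap S\neq N(v)\cap S$. For a set $X\subset V$, its density is $D(X)=\limsup_{k\to\infty}\frac{|X\cap N^k[u]|}{|N^k[u]|}$, where $u$ is any fixed vertex and $N^k[u]=\{x\in V: d(u,x)\le k\}$ with $d$ the graph distance. -}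

module Defs where

open import Data.Bool using (Bool; true; false; if_then_else_)
open import Data.Nat as ℕ using (ℕ; suc)
open import Data.Integer as ℤ using (ℤ; +_)
open import Data.Rational as ℚ using (ℚ; Positive)
open import Data.Product using (_×_; _,_; Σ; ∃; ∃-syntax; proj₁; proj₂)
open import Data.List using (List; map; upTo; concatMap)
open import Data.Nat.ListAction using (sum)
open import Relation.Binary.PropositionalEquality using (_≡_; _≢_)
open import Relation.Nullary using (¬_)
open import Function.Bundles using (_⇔_)
open import Data.Sum using (_⊎_)

V : Set
V = ℤ × ℤ

VSet : Set
VSet = V → Bool

_∈_ : V → VSet → Set
v ∈ S = S v ≡ true

_∉_ : V → VSet → Set
v ∉ S = S v ≡ false

dist² : V → V → ℤ
dist² (a , b) (c , d) = (a ℤ.- c) ℤ.* (a ℤ.- c) ℤ.+ (b ℤ.- d) ℤ.* (b ℤ.- d)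

Adj : V → V → Set
Adj u v = (u ≢ v) × (dist² u v ℤ.≤ + 2)

Dominating : VSet → Set
Dominating S = ∀ (v : V) → ∃[ w ] (((w ≡ v) ⊎ Adj v w) × w ∈ S)

HasPerfectMatching : VSet → Set
HasPerfectMatching S =
  Σ (V → V) λ m → ∀ (v : V) → v ∈ S →
    (m v ∈ S) × Adj v (m v) × (m (m v) ≡ v)

Locating : VSet → Set
Locating S = ∀ (u v : V) → u ∉ S → v ∉ S → u ≢ v →
  ¬ (∀ (w : V) → ((Adj u w × w ∈ S) ⇔ (Adj v w × w ∈ S)))

IsLPDS : VSet → Set
IsLPDS S = Dominating S × HasPerfectMatching S × Locating S

range : ℕ → List ℤ
range k = map (λ n → (+ n) ℤ.- (+ k)) (upTo (suc (2 ℕ.* k)))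

-- |S ∩ N^k[u]|, where N^k[u] (graph distance ≤ k in the king grid) is the
-- box of vertices at Chebyshev distance ≤ k from u.
count : VSet → V → ℕ → ℕ
count S (x , y) k =
  sum (concatMap (λ i → map (λ j → if S (x ℤ.+ i , y ℤ.+ j) then 1 else 0) (range k)) (range k))

ballSize : ℕ → ℕ
ballSize k = suc (2 ℕ.* k) ℕ.* suc (2 ℕ.* k)

ratio : VSet → V → ℕ → ℚ
ratio S u k = (+ count S u k) ℚ./ ballSize k

-- limsup of a rational sequence equals L (for bounded sequences):
LimsupEq : (ℕ → ℚ) → ℚ → Set
LimsupEq a L =
  (∀ (ε : ℚ) → Positive ε → ∃[ K ] (∀ k → K ℕ.≤ k → a k ℚ.≤ L ℚ.+ ε)) ×
  (∀ (ε : ℚ) → Positive ε → ∀ (K : ℕ) → ∃[ k ] ((K ℕ.≤ k) × (L ℚ.- ε ℚ.≤ a k)))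

HasDensity : VSet → ℚ → Set
HasDensity S L = ∀ (u : V) → LimsupEq (ratio S u) L

-- A 9 × 4 tile carrying 8 vertices has density 8/36 = 2/9. Cutting the plane into vertical
-- strips of width 9, each strip may independently be shifted up by one; this gives 2^ℵ₀
-- distinct sets. All three LPDS conditions are local: around (x, y) the set is determined,
-- in the band of horizontal distance at most 3, by x mod 9, the height of y in its tile and
-- the shifts of the three nearest strips, so they are verified by evaluating a decision
-- procedure on all 9 · 4 · 2³ local configurations. For the density, every column of the box
-- N^k[u] is 4-periodic and the column weights are 9-periodic with total 8, so the count is
-- 2/9 · (2k + 1)² up to O(k).

module Submission where

open import Defs
open import Data.Bool using (Bool; true; false; if_then_else_; _∧_; _∨_; not; _xor_)
open import Data.Bool.ListAction using (all; any)
open import Data.Bool.Properties using (not-injective; xor-same; T-≡)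
open import Data.Empty using (⊥; ⊥-elim)
open import Data.Integer as ℤ using (ℤ; +_; -[1+_]; ∣_∣; +≤+; _/ℕ_; _%ℕ_)
open import Data.Integer.DivMod using (a≡a%ℕn+[a/ℕn]*n; n%ℕd<d)
import Data.Integer.Properties as ℤP
open import Data.Integer.Tactic.RingSolver using () renaming (solve-∀ to ℤ-solve-∀)
open import Data.List using (List; []; _∷_; map; concatMap; applyUpTo)
open import Data.List.Membership.Propositional using () renaming (_∈_ to _∈ₗ_)
open import Data.List.Relation.Unary.All as All using (All)
open import Data.List.Relation.Unary.Any using (here; there)
open import Data.Nat as ℕ using (ℕ; zero; suc; z≤n; s≤s; NonZero; _+_; _*_; _≤_)
open import Data.Nat.DivMod using (m≡m%n+[m/n]*n; m%n<n; [m+n]%n≡m%n; m*n%n≡0; m*n/n≡m)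
open import Data.Nat.ListAction using (sum)
open import Data.Nat.ListAction.Properties using (sum-++)
import Data.Nat.Properties as ℕP
open import Data.Nat.Tactic.RingSolver using () renaming (solve-∀ to ℕ-solve-∀)
open import Data.Product using (Σ; _×_; _,_; proj₁; proj₂; ∃-syntax)
open import Data.Product.Properties using (≡-dec)
open import Data.Rational as ℚ using (mkℚ; Positive; ↥_; ↧ₙ_; _/_)
open import Data.Rational.Properties using (toℚᵘ-cancel-≤; toℚᵘ-homo-+; toℚᵘ-fromℚᵘ)
import Data.Rational.Unnormalised as ℚᵘ
import Data.Rational.Unnormalised.Properties as ℚᵘP
open import Data.Sum using (_⊎_; inj₁; inj₂; [_,_]′)
open import Function.Bundles using (_⇔_; mk⇔; Equivalence)
open import Relation.Binary.Definitions using (DecidableEquality; tri<; tri≈; tri>)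
open import Relation.Binary.PropositionalEquality
open import Relation.Nullary using (¬_; ¬?; _×-dec_)
open import Relation.Nullary.Decidable using (⌊_⌋; toWitness)

∧-true⁻ : ∀ a {b} → a ∧ b ≡ true → a ≡ true × b ≡ true
∧-true⁻ true b≡true = refl , b≡true

∨-true⁻ : ∀ a {b} → a ∨ b ≡ true → a ≡ true ⊎ b ≡ true
∨-true⁻ true  _      = inj₁ refl
∨-true⁻ false b≡true = inj₂ b≡true

all-∈ : ∀ {A : Set} (p : A → Bool) {xs x} → all p xs ≡ true → x ∈ₗ xs → p x ≡ true
all-∈ p {x ∷ _} h (here refl) = proj₁ (∧-true⁻ (p x) h)
all-∈ p {y ∷ _} h (there x∈) = all-∈ p (proj₂ (∧-true⁻ (p y) h)) x∈

any-witness : ∀ {A : Set} (p : A → Bool) xs → any p xs ≡ true → ∃[ x ] (p x ≡ true)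
any-witness p (x ∷ xs) h with ∨-true⁻ (p x) h
... | inj₁ px = x , px
... | inj₂ rest = any-witness p xs rest

all< : ℕ → (ℕ → Bool) → Bool
all< zero    p = true
all< (suc n) p = all< n p ∧ p n

all<-sound : ∀ n (p : ℕ → Bool) → all< n p ≡ true → ∀ {i} → i ℕ.< n → p i ≡ true
all<-sound (suc n) p h i<1+n with ∧-true⁻ (all< n p) h | ℕP.m<1+n⇒m<n∨m≡n i<1+n
... | below , _ | inj₁ i<n  = all<-sound n p below i<n
... | _ , pn    | inj₂ refl = pn

bool-ext : ∀ {a b} → (a ≡ true → b ≡ true) → (b ≡ true → a ≡ true) → a ≡ b
bool-ext {true}          a⇒b _   = sym (a⇒b refl)
bool-ext {false} {true}  _   b⇒a = b⇒a refl
bool-ext {false} {false} _   _   = refl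

allBool : (Bool → Bool) → Bool
allBool p = p true ∧ p false

allBool-sound : ∀ (p : Bool → Bool) → allBool p ≡ true → ∀ b → p b ≡ true
allBool-sound p h true  = proj₁ (∧-true⁻ (p true) h)
allBool-sound p h false = proj₂ (∧-true⁻ (p true) h)

allBool³ : (Bool → Bool → Bool → Bool) → Bool
allBool³ p = allBool λ a → allBool λ b → allBool λ c → p a b c

allBool³-sound : ∀ p → allBool³ p ≡ true → ∀ a b c → p a b c ≡ true
allBool³-sound p h a b c =
  allBool-sound (p a b) (allBool-sound (λ b → allBool (p a b)) (allBool-sound (λ a → allBool λ b → allBool (p a b)) h a) b) c

private
  +-cancelʳ : ∀ {a b} c → a ℤ.+ c ≡ b ℤ.+ c → a ≡ b
  +-cancelʳ {a} {b} c eq = trans (undo a c) (trans (cong (ℤ._- c) eq) (sym (undo b c)))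
    where
      undo : ∀ (a c : ℤ) → a ≡ (a ℤ.+ c) ℤ.- c
      undo = ℤ-solve-∀

  move-quotient : ∀ (r q d z : ℤ) → (r ℤ.+ q ℤ.* d) ℤ.+ z ≡ (r ℤ.+ z) ℤ.+ q ℤ.* d
  move-quotient = ℤ-solve-∀

  collect-quotients : ∀ (r q′ q d : ℤ) → (r ℤ.+ q′ ℤ.* d) ℤ.+ q ℤ.* d ≡ r ℤ.+ (q′ ℤ.+ q) ℤ.* d
  collect-quotients = ℤ-solve-∀

divisionForm-< : ∀ d r r′ (q q′ : ℤ) → r ℕ.< d → q ℤ.< q′ →
                 + r ℤ.+ q ℤ.* + d ℤ.< + r′ ℤ.+ q′ ℤ.* + d
divisionForm-< d r r′ q q′ r<d q<q′ = begin-strict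
  + r ℤ.+ q ℤ.* + d     <⟨ ℤP.+-monoˡ-< (q ℤ.* + d) (ℤ.+<+ r<d) ⟩
  + d ℤ.+ q ℤ.* + d     ≡⟨ sym (ℤP.suc-* q (+ d)) ⟩
  ℤ.suc q ℤ.* + d       ≤⟨ ℤP.*-monoʳ-≤-nonNeg (+ d) (ℤP.i<j⇒suc[i]≤j q<q′) ⟩
  q′ ℤ.* + d            ≤⟨ ℤP.i≤j+i (q′ ℤ.* + d) (+ r′) ⟩
  + r′ ℤ.+ q′ ℤ.* + d   ∎
  where open ℤP.≤-Reasoning

divMod-unique : ∀ x d .{{_ : NonZero d}} (r : ℕ) (q : ℤ) → r ℕ.< d →
                x ≡ + r ℤ.+ q ℤ.* + d → (x /ℕ d ≡ q) × (x %ℕ d ≡ r)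
divMod-unique x d r q r<d x≡ = quotient≡ , ℤP.+-injective (+-cancelʳ (q ℤ.* + d) remainders)
  where
    same : + r ℤ.+ q ℤ.* + d ≡ + (x %ℕ d) ℤ.+ (x /ℕ d) ℤ.* + d
    same = trans (sym x≡) (a≡a%ℕn+[a/ℕn]*n x d)
    quotient≡ : x /ℕ d ≡ q
    quotient≡ with ℤP.<-cmp q (x /ℕ d)
    ... | tri< q<q′ _ _ = ⊥-elim (ℤP.<-irrefl same (divisionForm-< d r _ q _ r<d q<q′))
    ... | tri≈ _ q≡q′ _ = sym q≡q′
    ... | tri> _ _ q′<q = ⊥-elim (ℤP.<-irrefl (sym same) (divisionForm-< d _ r _ q (n%ℕd<d x d) q′<q))
    remainders : + (x %ℕ d) ℤ.+ q ℤ.* + d ≡ + r ℤ.+ q ℤ.* + d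
    remainders = sym (trans same (cong (λ q′ → + (x %ℕ d) ℤ.+ q′ ℤ.* + d) quotient≡))

divMod-+ : ∀ x z d .{{_ : NonZero d}} →
           ((x ℤ.+ z) /ℕ d ≡ (+ (x %ℕ d) ℤ.+ z) /ℕ d ℤ.+ x /ℕ d) ×
           ((x ℤ.+ z) %ℕ d ≡ (+ (x %ℕ d) ℤ.+ z) %ℕ d)
divMod-+ x z d = divMod-unique (x ℤ.+ z) d (w %ℕ d) (w /ℕ d ℤ.+ x /ℕ d) (n%ℕd<d w d) (begin
  x ℤ.+ z                                               ≡⟨ cong (ℤ._+ z) (a≡a%ℕn+[a/ℕn]*n x d) ⟩
  (+ (x %ℕ d) ℤ.+ x /ℕ d ℤ.* + d) ℤ.+ z                 ≡⟨ move-quotient (+ (x %ℕ d)) (x /ℕ d) (+ d) z ⟩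
  w ℤ.+ x /ℕ d ℤ.* + d                                  ≡⟨ cong (ℤ._+ x /ℕ d ℤ.* + d) (a≡a%ℕn+[a/ℕn]*n w d) ⟩
  (+ (w %ℕ d) ℤ.+ w /ℕ d ℤ.* + d) ℤ.+ x /ℕ d ℤ.* + d    ≡⟨ collect-quotients (+ (w %ℕ d)) (w /ℕ d) (x /ℕ d) (+ d) ⟩
  + (w %ℕ d) ℤ.+ (w /ℕ d ℤ.+ x /ℕ d) ℤ.* + d            ∎)
  where
    w = + (x %ℕ d) ℤ.+ z
    open ≡-Reasoning

infixl 6 _⊕_ _⊖_

_⊕_ : V → V → V
(a , b) ⊕ (c , d) = (a ℤ.+ c , b ℤ.+ d)

_⊖_ : V → V → V
(a , b) ⊖ (c , d) = (a ℤ.- c , b ℤ.- d)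

origin : V
origin = (+ 0 , + 0)

_≟V_ : DecidableEquality V
_≟V_ = ≡-dec ℤ._≟_ ℤ._≟_

isOrigin : V → Bool
isOrigin d = ⌊ d ≟V origin ⌋

isOrigin⇒≡ : ∀ {d} → isOrigin d ≡ true → d ≡ origin
isOrigin⇒≡ {d} h = toWitness {a? = d ≟V origin} (Equivalence.from T-≡ h)

private
  ⊕-⊖-cancel₁ : ∀ (a d : ℤ) → (a ℤ.+ d) ℤ.- a ≡ d
  ⊕-⊖-cancel₁ = ℤ-solve-∀

  ⊖-⊕-cancel₁ : ∀ (a w : ℤ) → a ℤ.+ (w ℤ.- a) ≡ w
  ⊖-⊕-cancel₁ = ℤ-solve-∀

  ⊕-⊖-⊕₁ : ∀ (a b c : ℤ) → (a ℤ.+ c) ℤ.- (a ℤ.+ b) ≡ c ℤ.- b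
  ⊕-⊖-⊕₁ = ℤ-solve-∀

  ⊕-⊖-back₁ : ∀ (a c b : ℤ) → a ℤ.+ (c ℤ.- ((a ℤ.+ c) ℤ.- b)) ≡ b
  ⊕-⊖-back₁ = ℤ-solve-∀

⊕-identityʳ : ∀ u → u ⊕ origin ≡ u
⊕-identityʳ (a , b) = cong₂ _,_ (ℤP.+-identityʳ a) (ℤP.+-identityʳ b)

⊕-assoc : ∀ u v w → (u ⊕ v) ⊕ w ≡ u ⊕ (v ⊕ w)
⊕-assoc (a , b) (c , d) (e , f) = cong₂ _,_ (ℤP.+-assoc a c e) (ℤP.+-assoc b d f)

⊖-self : ∀ u → u ⊖ u ≡ origin
⊖-self (a , b) = cong₂ _,_ (ℤP.+-inverseʳ a) (ℤP.+-inverseʳ b)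

⊕-⊖-cancel : ∀ u d → (u ⊕ d) ⊖ u ≡ d
⊕-⊖-cancel (a , b) (c , d) = cong₂ _,_ (⊕-⊖-cancel₁ a c) (⊕-⊖-cancel₁ b d)

⊖-⊕-cancel : ∀ u w → u ⊕ (w ⊖ u) ≡ w
⊖-⊕-cancel (a , b) (c , d) = cong₂ _,_ (⊖-⊕-cancel₁ a c) (⊖-⊕-cancel₁ b d)

⊕-⊖-⊕ : ∀ u v w → (u ⊕ w) ⊖ (u ⊕ v) ≡ w ⊖ v
⊕-⊖-⊕ (a , b) (c , d) (e , f) = cong₂ _,_ (⊕-⊖-⊕₁ a c e) (⊕-⊖-⊕₁ b d f)

⊕-⊖-back : ∀ u d v → u ⊕ (d ⊖ ((u ⊕ d) ⊖ v)) ≡ v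
⊕-⊖-back (a , b) (c , d) (e , f) = cong₂ _,_ (⊕-⊖-back₁ a c e) (⊕-⊖-back₁ b d f)

norm² : V → ℤ
norm² (a , b) = a ℤ.* a ℤ.+ b ℤ.* b

dist²≡norm²-⊖ : ∀ u w → dist² u w ≡ norm² (w ⊖ u)
dist²≡norm²-⊖ (a , b) (c , d) = cong₂ ℤ._+_ (square-⊖-comm a c) (square-⊖-comm b d)
  where
    square-⊖-comm : ∀ (a c : ℤ) → (a ℤ.- c) ℤ.* (a ℤ.- c) ≡ (c ℤ.- a) ℤ.* (c ℤ.- a)
    square-⊖-comm = ℤ-solve-∀

KingStep : V → Set
KingStep d = d ≢ origin × norm² d ℤ.≤ + 2

Adj⇔KingStep : ∀ u w → Adj u w ⇔ KingStep (w ⊖ u)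
Adj⇔KingStep u w = mk⇔
  (λ (u≢w , close) → (λ w⊖u≡0 → u≢w (sym (step w⊖u≡0))) , subst (ℤ._≤ + 2) (dist²≡norm²-⊖ u w) close)
  (λ (w⊖u≢0 , close) → (λ u≡w → w⊖u≢0 (trans (cong (_⊖ u) (sym u≡w)) (⊖-self u))) ,
                       subst (ℤ._≤ + 2) (sym (dist²≡norm²-⊖ u w)) close)
  where
    step : w ⊖ u ≡ origin → w ≡ u
    step w⊖u≡0 = begin
      w                ≡⟨ sym (⊖-⊕-cancel u w) ⟩
      u ⊕ (w ⊖ u)      ≡⟨ cong (u ⊕_) w⊖u≡0 ⟩
      u ⊕ origin       ≡⟨ ⊕-identityʳ u ⟩
      u                ∎
      where open ≡-Reasoning

kingMoves : List V
kingMoves = (+ 1 , + 0) ∷ (+ 1 , + 1) ∷ (+ 0 , + 1) ∷ (-[1+ 0 ] , + 1) ∷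
            (-[1+ 0 ] , + 0) ∷ (-[1+ 0 ] , -[1+ 0 ]) ∷ (+ 0 , -[1+ 0 ]) ∷ (+ 1 , -[1+ 0 ]) ∷ []

open import Data.List.Membership.DecPropositional _≟V_ using (_∈?_)

isKingMove : V → Bool
isKingMove d = ⌊ d ∈? kingMoves ⌋

isKingMove⇒∈ : ∀ {d} → isKingMove d ≡ true → d ∈ₗ kingMoves
isKingMove⇒∈ {d} h = toWitness {a? = d ∈? kingMoves} (Equivalence.from T-≡ h)

kingMoves-KingStep : All KingStep kingMoves
kingMoves-KingStep = toWitness {a? = All.all? (λ d → ¬? (d ≟V origin) ×-dec (norm² d ℤ.≤? + 2)) kingMoves} _

private
  square≡∣∣² : ∀ i → i ℤ.* i ≡ + (∣ i ∣ ℕ.* ∣ i ∣)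
  square≡∣∣² (+ n)    = sym (ℤP.pos-* n n)
  square≡∣∣² -[1+ n ] = trans (neg-square (+ suc n)) (sym (ℤP.pos-* (suc n) (suc n)))
    where
      neg-square : ∀ (a : ℤ) → (ℤ.- a) ℤ.* (ℤ.- a) ≡ a ℤ.* a
      neg-square = ℤ-solve-∀

  n*n≤2⇒n≤1 : ∀ n → n ℕ.* n ℕ.≤ 2 → n ℕ.≤ 1
  n*n≤2⇒n≤1 0 _ = z≤n
  n*n≤2⇒n≤1 1 _ = s≤s z≤n
  n*n≤2⇒n≤1 (suc (suc n)) h = ⊥-elim (4≰2 (ℕP.≤-trans (ℕP.*-mono-≤ {2} {suc (suc n)} {2} (s≤s (s≤s z≤n)) (s≤s (s≤s z≤n))) h))
    where
      4≰2 : ¬ 4 ℕ.≤ 2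
      4≰2 (s≤s (s≤s ()))

  unitStep-isKingMove : ∀ a b → (a , b) ≢ origin → ∣ a ∣ ℕ.≤ 1 → ∣ b ∣ ℕ.≤ 1 → isKingMove (a , b) ≡ true
  unitStep-isKingMove (+ suc (suc _)) _ _ (s≤s ()) _
  unitStep-isKingMove -[1+ suc _ ]    _ _ (s≤s ()) _
  unitStep-isKingMove _ (+ suc (suc _)) _ _ (s≤s ())
  unitStep-isKingMove _ -[1+ suc _ ]    _ _ (s≤s ())
  unitStep-isKingMove (+ 0)    (+ 0)    ≢0 _ _ = ⊥-elim (≢0 refl)
  unitStep-isKingMove (+ 0)    (+ 1)    _ _ _ = refl
  unitStep-isKingMove (+ 0)    -[1+ 0 ] _ _ _ = refl
  unitStep-isKingMove (+ 1)    (+ 0)    _ _ _ = refl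
  unitStep-isKingMove (+ 1)    (+ 1)    _ _ _ = refl
  unitStep-isKingMove (+ 1)    -[1+ 0 ] _ _ _ = refl
  unitStep-isKingMove -[1+ 0 ] (+ 0)    _ _ _ = refl
  unitStep-isKingMove -[1+ 0 ] (+ 1)    _ _ _ = refl
  unitStep-isKingMove -[1+ 0 ] -[1+ 0 ] _ _ _ = refl

KingStep⇒isKingMove : ∀ d → KingStep d → isKingMove d ≡ true
KingStep⇒isKingMove (a , b) (≢0 , close) =
  unitStep-isKingMove a b ≢0 (n*n≤2⇒n≤1 _ (ℕP.≤-trans (ℕP.m≤m+n _ _) squares≤2))
                             (n*n≤2⇒n≤1 _ (ℕP.≤-trans (ℕP.m≤n+m _ _) squares≤2))
  where
    squares≤2 : ∣ a ∣ ℕ.* ∣ a ∣ ℕ.+ ∣ b ∣ ℕ.* ∣ b ∣ ℕ.≤ 2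
    squares≤2 = ℤP.drop‿+≤+ (subst (ℤ._≤ + 2)
      (trans (cong₂ ℤ._+_ (square≡∣∣² a) (square≡∣∣² b)) (sym (ℤP.pos-+ (∣ a ∣ ℕ.* ∣ a ∣) (∣ b ∣ ℕ.* ∣ b ∣)))) close)

Adj⇔isKingMove : ∀ u w → Adj u w ⇔ isKingMove (w ⊖ u) ≡ true
Adj⇔isKingMove u w = mk⇔
  (λ adj → KingStep⇒isKingMove _ (Equivalence.to (Adj⇔KingStep u w) adj))
  (λ h → Equivalence.from (Adj⇔KingStep u w) (All.lookup kingMoves-KingStep (isKingMove⇒∈ h)))

isKingMove⇒Adj : ∀ u {d} → isKingMove d ≡ true → Adj u (u ⊕ d)
isKingMove⇒Adj u {d} h = Equivalence.from (Adj⇔isKingMove u (u ⊕ d)) (trans (cong isKingMove (⊕-⊖-cancel u d)) h)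

sameTrace⇒isKingMove≡ : ∀ {S : VSet} {u v} → (∀ w → (Adj u w × w ∈ S) ⇔ (Adj v w × w ∈ S)) →
                        ∀ {w} → w ∈ S → isKingMove (w ⊖ u) ≡ isKingMove (w ⊖ v)
sameTrace⇒isKingMove≡ {S} {u} {v} same {w} w∈S = bool-ext
  (λ h → Equivalence.to (Adj⇔isKingMove v w) (proj₁ (Equivalence.to (same w) (Equivalence.from (Adj⇔isKingMove u w) h , w∈S))))
  (λ h → Equivalence.to (Adj⇔isKingMove u w) (proj₁ (Equivalence.from (same w) (Equivalence.from (Adj⇔isKingMove v w) h , w∈S))))

inWindow : V → Bool
inWindow (dx , _) = ∣ dx ∣ ℕ.≤ᵇ 3

window : List V
window = concatMap (λ a → map (a ,_) (range 3)) (range 3)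

first : (V → Bool) → List V → V
first p []       = origin
first p (d ∷ ds) = if p d then d else first p ds

first-cong : ∀ (p q : V → Bool) ds → (∀ {d} → d ∈ₗ ds → p d ≡ q d) → first p ds ≡ first q ds
first-cong p q []       _  = refl
first-cong p q (d ∷ ds) eq rewrite eq (here refl) with q d
... | true  = refl
... | false = first-cong p q ds (λ d∈ → eq (there d∈))

partner : VSet → V → V
partner S u = u ⊕ first (λ d → S (u ⊕ d)) kingMoves

module LocalCheck (τ : V → Bool) where

  step : V
  step = first τ kingMoves

  returns : Bool
  returns = all (λ e → inWindow (step ⊕ e)) kingMoves ∧
            isOrigin (step ⊕ first (λ e → τ (step ⊕ e)) kingMoves)

  separates : V → V → Bool
  separates δ d = inWindow d ∧ τ d ∧ (isKingMove d xor isKingMove (d ⊖ δ))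

  excluded : V → Bool
  excluded δ = inWindow δ ∧ (isOrigin δ ∨ τ δ ∨ any (separates δ) window)

  -- A vertex v ∉ S with the trace of u is adjacent to u ⊕ step, so v = u ⊕ (step ⊖ e) for a
  -- king move e; locates rules out each such candidate.
  locates : Bool
  locates = all (λ e → excluded (step ⊖ e)) kingMoves

  accepts : Bool
  accepts = τ step ∧ isKingMove step ∧ (if τ origin then returns else locates)

module LocalSoundness (S : VSet) (u : V) (τ : V → Bool)
                      (agree : ∀ d → inWindow d ≡ true → S (u ⊕ d) ≡ τ d)
                      (ok : LocalCheck.accepts τ ≡ true) where
  open LocalCheck τ

  private
    τ-step : τ step ≡ true
    τ-step = proj₁ (∧-true⁻ (τ step) ok)

    step-king : isKingMove step ≡ true
    step-king = proj₁ (∧-true⁻ (isKingMove step) (proj₂ (∧-true⁻ (τ step) ok)))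

    branch : (if τ origin then returns else locates) ≡ true
    branch = proj₂ (∧-true⁻ (isKingMove step) (proj₂ (∧-true⁻ (τ step) ok)))

    inWindow-kingMove : ∀ {d} → isKingMove d ≡ true → inWindow d ≡ true
    inWindow-kingMove h = all-∈ inWindow {kingMoves} refl (isKingMove⇒∈ h)

    S-u : S u ≡ τ origin
    S-u = trans (cong S (sym (⊕-identityʳ u))) (agree origin refl)

    step∈S : (u ⊕ step) ∈ S
    step∈S = trans (agree step (inWindow-kingMove step-king)) τ-step

  dominated : ∃[ w ] (((w ≡ u) ⊎ Adj u w) × w ∈ S)
  dominated = u ⊕ step , inj₂ (isKingMove⇒Adj u step-king) , step∈S

  matched : u ∈ S → (partner S u ∈ S) × Adj u (partner S u) × (partner S (partner S u) ≡ u)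
  matched u∈S = subst (_∈ S) (sym partner≡) step∈S ,
                subst (Adj u) (sym partner≡) (isKingMove⇒Adj u step-king) ,
                involutive
    where
      back = first (λ e → τ (step ⊕ e)) kingMoves
      windowAtStep = all (λ e → inWindow (step ⊕ e)) kingMoves

      returns-ok : windowAtStep ≡ true × isOrigin (step ⊕ back) ≡ true
      returns-ok = ∧-true⁻ windowAtStep (subst (λ b → (if b then returns else locates) ≡ true) (trans (sym S-u) u∈S) branch)

      partner≡ : partner S u ≡ u ⊕ step
      partner≡ = cong (u ⊕_) (first-cong _ τ kingMoves (λ d∈ → agree _ (all-∈ inWindow {kingMoves} refl d∈)))

      partner-step≡ : partner S (u ⊕ step) ≡ (u ⊕ step) ⊕ back
      partner-step≡ = cong ((u ⊕ step) ⊕_) (first-cong _ _ kingMoves (λ {e} e∈ →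
        trans (cong S (⊕-assoc u step e))
              (agree (step ⊕ e) (all-∈ (λ e → inWindow (step ⊕ e)) {kingMoves} (proj₁ returns-ok) e∈))))

      involutive : partner S (partner S u) ≡ u
      involutive = begin
        partner S (partner S u)   ≡⟨ cong (partner S) partner≡ ⟩
        partner S (u ⊕ step)      ≡⟨ partner-step≡ ⟩
        (u ⊕ step) ⊕ back         ≡⟨ ⊕-assoc u step back ⟩
        u ⊕ (step ⊕ back)         ≡⟨ cong (u ⊕_) (isOrigin⇒≡ (proj₂ returns-ok)) ⟩
        u ⊕ origin                ≡⟨ ⊕-identityʳ u ⟩
        u                         ∎
        where open ≡-Reasoning

  located : ∀ v → u ∉ S → v ∉ S → u ≢ v → ¬ (∀ w → (Adj u w × w ∈ S) ⇔ (Adj v w × w ∈ S))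
  located v u∉S v∉S u≢v same = refute (∧-true⁻ (inWindow δ) excludedδ)
    where
      true≢false : true ≢ false
      true≢false ()

      e = (u ⊕ step) ⊖ v
      e-king : isKingMove e ≡ true
      e-king = trans (sym (sameTrace⇒isKingMove≡ same step∈S))
                     (trans (cong isKingMove (⊕-⊖-cancel u step)) step-king)

      δ = step ⊖ e
      u⊕δ≡v : u ⊕ δ ≡ v
      u⊕δ≡v = ⊕-⊖-back u step v

      excludedδ : excluded δ ≡ true
      excludedδ = all-∈ (λ e → excluded (step ⊖ e)) {kingMoves}
        (subst (λ b → (if b then returns else locates) ≡ true) (trans (sym S-u) u∉S) branch) (isKingMove⇒∈ e-king)

      notSeparated : ∃[ d ] (separates δ d ≡ true) → ⊥
      notSeparated (d , d-sep) =
        true≢false (trans (sym differs) (trans (cong (_xor isKingMove (d ⊖ δ)) king≡) (xor-same (isKingMove (d ⊖ δ)))))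
        where
          d-window = proj₁ (∧-true⁻ (inWindow d) d-sep)
          τd = proj₁ (∧-true⁻ (τ d) (proj₂ (∧-true⁻ (inWindow d) d-sep)))
          differs = proj₂ (∧-true⁻ (τ d) (proj₂ (∧-true⁻ (inWindow d) d-sep)))
          king≡ : isKingMove d ≡ isKingMove (d ⊖ δ)
          king≡ = begin
            isKingMove d                     ≡⟨ cong isKingMove (sym (⊕-⊖-cancel u d)) ⟩
            isKingMove ((u ⊕ d) ⊖ u)         ≡⟨ sameTrace⇒isKingMove≡ same (trans (agree d d-window) τd) ⟩
            isKingMove ((u ⊕ d) ⊖ v)         ≡⟨ cong (λ x → isKingMove ((u ⊕ d) ⊖ x)) (sym u⊕δ≡v) ⟩
            isKingMove ((u ⊕ d) ⊖ (u ⊕ δ))   ≡⟨ cong isKingMove (⊕-⊖-⊕ u δ d) ⟩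
            isKingMove (d ⊖ δ)               ∎
            where open ≡-Reasoning

      refute : inWindow δ ≡ true × (isOrigin δ ∨ τ δ ∨ any (separates δ) window) ≡ true → ⊥
      refute (δ-window , rest) =
        [ isOrigin-case , (λ rest′ → [ τ-case , separated-case ]′ (∨-true⁻ (τ δ) rest′)) ]′ (∨-true⁻ (isOrigin δ) rest)
        where
          isOrigin-case : isOrigin δ ≡ true → ⊥
          isOrigin-case δ≡0 = u≢v (trans (sym (⊕-identityʳ u)) (trans (cong (u ⊕_) (sym (isOrigin⇒≡ δ≡0))) u⊕δ≡v))
          τ-case : τ δ ≡ true → ⊥
          τ-case τδ = true≢false (trans (sym τδ) (trans (sym (agree δ δ-window)) (trans (cong S u⊕δ≡v) v∉S)))
          separated-case : any (separates δ) window ≡ true → ⊥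
          separated-case sep = notSeparated (any-witness (separates δ) window sep)

tile : ℕ → ℕ → Bool
tile 0 0 = true
tile 0 1 = true
tile 2 3 = true
tile 3 0 = true
tile 4 2 = true
tile 5 1 = true
tile 7 2 = true
tile 7 3 = true
tile _ _ = false

shift : Bool → ℤ
shift true  = + 1
shift false = + 0

strip : ℤ → ℤ
strip x = x /ℕ 9

column : ℤ → ℕ
column x = x %ℕ 9

height : (ℤ → Bool) → V → ℕ
height s (x , y) = (y ℤ.- shift (s (strip x))) %ℕ 4

stripTiling : (ℤ → Bool) → VSet
stripTiling s u = tile (column (proj₁ u)) (height s u)

-- The bit of the strip c steps to the right, for ∣ c ∣ ≤ 1.
stripBit : ℤ → Bool → Bool → Bool → Bool
stripBit (+ 0)    _  b₀ _  = b₀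
stripBit (+ 1)    _  _  b₊ = b₊
stripBit -[1+ 0 ] b₋ _  _  = b₋
stripBit _        _  _  _  = false

stripBit-correct : ∀ (s : ℤ → Bool) q c → ∣ c ∣ ℕ.≤ 1 →
                   s (c ℤ.+ q) ≡ stripBit c (s (-[1+ 0 ] ℤ.+ q)) (s q) (s (+ 1 ℤ.+ q))
stripBit-correct s q (+ 0)    _ = cong s (ℤP.+-identityˡ q)
stripBit-correct s q (+ 1)    _ = refl
stripBit-correct s q -[1+ 0 ] _ = refl
stripBit-correct s q (+ suc (suc _)) (s≤s ())
stripBit-correct s q -[1+ suc _ ]    (s≤s ())

window-nearStrip : ∀ {r} dx → r ℕ.< 9 → (∣ dx ∣ ℕ.≤ᵇ 3) ≡ true → ∣ (+ r ℤ.+ dx) /ℕ 9 ∣ ℕ.≤ 1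
window-nearStrip {r} dx r<9 dx-small = ℕP.≤ᵇ⇒≤ _ 1 (Equivalence.from T-≡ (strips dx dx-small))
  where
    near : ℤ → ℕ → Bool
    near dx r = ∣ (+ r ℤ.+ dx) /ℕ 9 ∣ ℕ.≤ᵇ 1
    strips : ∀ dx → (∣ dx ∣ ℕ.≤ᵇ 3) ≡ true → near dx r ≡ true
    strips (+ 0)    _ = all<-sound 9 (near (+ 0)) refl r<9
    strips (+ 1)    _ = all<-sound 9 (near (+ 1)) refl r<9
    strips (+ 2)    _ = all<-sound 9 (near (+ 2)) refl r<9
    strips (+ 3)    _ = all<-sound 9 (near (+ 3)) refl r<9
    strips -[1+ 0 ] _ = all<-sound 9 (near -[1+ 0 ]) refl r<9
    strips -[1+ 1 ] _ = all<-sound 9 (near -[1+ 1 ]) refl r<9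
    strips -[1+ 2 ] _ = all<-sound 9 (near -[1+ 2 ]) refl r<9
    strips (+ suc (suc (suc (suc _)))) ()
    strips -[1+ suc (suc (suc _)) ]    ()

-- At horizontal distance at most 3 the tiling only depends on x mod 9, on the height of y
-- within its tile and on the bits of the three nearest strips.
localView : ℕ → ℕ → Bool → Bool → Bool → V → Bool
localView r j b₋ b₀ b₊ (dx , dy) =
  tile ((+ r ℤ.+ dx) %ℕ 9)
       ((+ j ℤ.+ ((dy ℤ.+ shift b₀) ℤ.- shift (stripBit ((+ r ℤ.+ dx) /ℕ 9) b₋ b₀ b₊))) %ℕ 4)

stripTiling-localView : ∀ s x y d → inWindow d ≡ true →
  stripTiling s ((x , y) ⊕ d) ≡ localView (column x) (height s (x , y))
                                          (s (-[1+ 0 ] ℤ.+ strip x)) (s (strip x)) (s (+ 1 ℤ.+ strip x)) d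
stripTiling-localView s x y (dx , dy) dx-small = begin
  tile ((x ℤ.+ dx) %ℕ 9) (((y ℤ.+ dy) ℤ.- shift (s ((x ℤ.+ dx) /ℕ 9))) %ℕ 4)
    ≡⟨ cong₂ (λ a b → tile a (((y ℤ.+ dy) ℤ.- shift (s b)) %ℕ 4)) (proj₂ columnDivision) (proj₁ columnDivision) ⟩
  tile r′ (((y ℤ.+ dy) ℤ.- shift (s (c ℤ.+ q))) %ℕ 4)
    ≡⟨ cong (λ b → tile r′ (((y ℤ.+ dy) ℤ.- shift b) %ℕ 4))
            (stripBit-correct s q c (window-nearStrip dx (n%ℕd<d x 9) dx-small)) ⟩
  tile r′ (((y ℤ.+ dy) ℤ.- shift b′) %ℕ 4)
    ≡⟨ cong (λ z → tile r′ (z %ℕ 4)) (regroup-height y dy (shift (s q)) (shift b′)) ⟩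
  tile r′ ((t ℤ.+ z) %ℕ 4)
    ≡⟨ cong (tile r′) (proj₂ (divMod-+ t z 4)) ⟩
  tile r′ ((+ (t %ℕ 4) ℤ.+ z) %ℕ 4) ∎
  where
    open ≡-Reasoning
    q  = x /ℕ 9
    r′ = (+ (x %ℕ 9) ℤ.+ dx) %ℕ 9
    c  = (+ (x %ℕ 9) ℤ.+ dx) /ℕ 9
    columnDivision = divMod-+ x dx 9
    b′ = stripBit c (s (-[1+ 0 ] ℤ.+ q)) (s q) (s (+ 1 ℤ.+ q))
    t  = y ℤ.- shift (s q)
    z  = (dy ℤ.+ shift (s q)) ℤ.- shift b′
    regroup-height : ∀ (y dy b₀ b′ : ℤ) → (y ℤ.+ dy) ℤ.- b′ ≡ (y ℤ.- b₀) ℤ.+ ((dy ℤ.+ b₀) ℤ.- b′)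
    regroup-height = ℤ-solve-∀

localView-accepts : ∀ r j → r ℕ.< 9 → j ℕ.< 4 → ∀ b₋ b₀ b₊ →
                    LocalCheck.accepts (localView r j b₋ b₀ b₊) ≡ true
localView-accepts r j r<9 j<4 = allBool³-sound (accepts r j)
  (all<-sound 4 (λ j → allBool³ (accepts r j)) (all<-sound 9 (λ r → all< 4 λ j → allBool³ (accepts r j)) refl r<9) j<4)
  where
    accepts : ℕ → ℕ → Bool → Bool → Bool → Bool
    accepts r j b₋ b₀ b₊ = LocalCheck.accepts (localView r j b₋ b₀ b₊)

-- The local view is given explicitly so that the type of localView-accepts matches it
-- syntactically; otherwise Agda evaluates the checker on symbolic arguments.
stripTiling-isLPDS : ∀ s → IsLPDS (stripTiling s)
stripTiling-isLPDS s =
  (λ (x , y) → At.dominated x y) , (partner (stripTiling s) , λ (x , y) → At.matched x y) , (λ (x , y) v → At.located x y v)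
  where
    module At (x y : ℤ) = LocalSoundness (stripTiling s) (x , y)
      (localView (column x) (height s (x , y)) (s (-[1+ 0 ] ℤ.+ strip x)) (s (strip x)) (s (+ 1 ℤ.+ strip x)))
      (stripTiling-localView s x y)
      (localView-accepts (column x) (height s (x , y)) (n%ℕd<d x 9) (n%ℕd<d (y ℤ.- shift (s (strip x))) 4)
                         (s (-[1+ 0 ] ℤ.+ strip x)) (s (strip x)) (s (+ 1 ℤ.+ strip x)))

Σ< : ℕ → (ℕ → ℕ) → ℕ
Σ< zero    f = 0
Σ< (suc n) f = f 0 + Σ< n (λ i → f (suc i))

Σ<-cong : ∀ n {f g : ℕ → ℕ} → (∀ i → f i ≡ g i) → Σ< n f ≡ Σ< n g
Σ<-cong zero    eq = refl
Σ<-cong (suc n) eq = cong₂ _+_ (eq 0) (Σ<-cong n (λ i → eq (suc i)))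

Σ<-mono-≤ : ∀ n {f g : ℕ → ℕ} → (∀ i → f i ≤ g i) → Σ< n f ≤ Σ< n g
Σ<-mono-≤ zero    le = z≤n
Σ<-mono-≤ (suc n) le = ℕP.+-mono-≤ (le 0) (Σ<-mono-≤ n (λ i → le (suc i)))

Σ<-+ : ∀ n (f g : ℕ → ℕ) → Σ< n (λ i → f i + g i) ≡ Σ< n f + Σ< n g
Σ<-+ zero    f g = refl
Σ<-+ (suc n) f g = trans (cong (f 0 + g 0 ℕ.+_) (Σ<-+ n _ _)) (interchange (f 0) (g 0) _ _)
  where
    interchange : ∀ a b c d → a + b + (c + d) ≡ a + c + (b + d)
    interchange = ℕ-solve-∀

Σ<-*ˡ : ∀ n a (f : ℕ → ℕ) → Σ< n (λ i → a * f i) ≡ a * Σ< n f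
Σ<-*ˡ zero    a f = sym (ℕP.*-zeroʳ a)
Σ<-*ˡ (suc n) a f = trans (cong (a * f 0 ℕ.+_) (Σ<-*ˡ n a _)) (sym (ℕP.*-distribˡ-+ a (f 0) _))

Σ<-split : ∀ m n (f : ℕ → ℕ) → Σ< (m + n) f ≡ Σ< m f + Σ< n (λ i → f (m + i))
Σ<-split zero    n f = refl
Σ<-split (suc m) n f = trans (cong (f 0 ℕ.+_) (Σ<-split m n _)) (sym (ℕP.+-assoc (f 0) _ _))

module PeriodicSum (h : ℕ → ℕ) (P : ℕ) (periodic : ∀ i → h (P + i) ≡ h i) where

  translate-periodic : ∀ a i → h (a + (P + i)) ≡ h (a + i)
  translate-periodic a i = trans (cong h (swap a P i)) (periodic (a + i))
    where
      swap : ∀ a P i → a + (P + i) ≡ P + (a + i)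
      swap = ℕ-solve-∀

  Σ<-period-+ : ∀ n → Σ< (P + n) h ≡ Σ< P h + Σ< n h
  Σ<-period-+ n = trans (Σ<-split P n h) (cong (Σ< P h ℕ.+_) (Σ<-cong n periodic))

  Σ<-periods : ∀ m t → Σ< (m * P + t) h ≡ m * Σ< P h + Σ< t h
  Σ<-periods zero    t = refl
  Σ<-periods (suc m) t = begin
    Σ< (P + m * P + t) h              ≡⟨ cong (λ n → Σ< n h) (ℕP.+-assoc P (m * P) t) ⟩
    Σ< (P + (m * P + t)) h            ≡⟨ Σ<-period-+ (m * P + t) ⟩
    Σ< P h + Σ< (m * P + t) h         ≡⟨ cong (Σ< P h ℕ.+_) (Σ<-periods m t) ⟩
    Σ< P h + (m * Σ< P h + Σ< t h)    ≡⟨ sym (ℕP.+-assoc (Σ< P h) _ _) ⟩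
    suc m * Σ< P h + Σ< t h           ∎
    where open ≡-Reasoning

  Σ<-≤-period : ∀ {t} → t ≤ P → Σ< t h ≤ Σ< P h
  Σ<-≤-period {t} t≤P = begin
    Σ< t h                                 ≤⟨ ℕP.m≤m+n _ _ ⟩
    Σ< t h + Σ< (P ℕ.∸ t) (λ i → h (t + i)) ≡⟨ sym (Σ<-split t (P ℕ.∸ t) h) ⟩
    Σ< (t + (P ℕ.∸ t)) h                   ≡⟨ cong (λ n → Σ< n h) (ℕP.m+[n∸m]≡n t≤P) ⟩
    Σ< P h                                 ∎
    where open ℕP.≤-Reasoning

  Σ<-bounds : .{{_ : NonZero P}} → ∀ n →
              (n * Σ< P h ≤ P * Σ< n h + P * Σ< P h) × (P * Σ< n h ≤ n * Σ< P h + P * Σ< P h)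
  Σ<-bounds n = subst Bounds (sym n≡) (lower , upper)
    where
      Bounds : ℕ → Set
      Bounds n = (n * Σ< P h ≤ P * Σ< n h + P * Σ< P h) × (P * Σ< n h ≤ n * Σ< P h + P * Σ< P h)
      m = n ℕ./ P
      t = n ℕ.% P
      c = Σ< P h
      n≡ : n ≡ m * P + t
      n≡ = trans (m≡m%n+[m/n]*n n P) (ℕP.+-comm t (m * P))
      t≤P : t ≤ P
      t≤P = ℕP.<⇒≤ (m%n<n n P)
      lower : (m * P + t) * c ≤ P * Σ< (m * P + t) h + P * c
      lower = begin
        (m * P + t) * c                     ≡⟨ expand c m P t ⟩
        P * (m * c) + t * c                 ≤⟨ ℕP.+-mono-≤ (ℕP.m≤m+n (P * (m * c)) (P * Σ< t h)) (ℕP.*-monoˡ-≤ c t≤P) ⟩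
        (P * (m * c) + P * Σ< t h) + P * c  ≡⟨ regroup c m P (Σ< t h) ⟩
        P * (m * c + Σ< t h) + P * c        ≡⟨ cong (λ s → P * s + P * c) (sym (Σ<-periods m t)) ⟩
        P * Σ< (m * P + t) h + P * c        ∎
        where
          open ℕP.≤-Reasoning
          expand : ∀ c m P t → (m * P + t) * c ≡ P * (m * c) + t * c
          expand = ℕ-solve-∀
          regroup : ∀ c m P w → (P * (m * c) + P * w) + P * c ≡ P * (m * c + w) + P * c
          regroup = ℕ-solve-∀
      upper : P * Σ< (m * P + t) h ≤ (m * P + t) * c + P * c
      upper = begin
        P * Σ< (m * P + t) h           ≡⟨ cong (P *_) (Σ<-periods m t) ⟩
        P * (m * c + Σ< t h)           ≤⟨ ℕP.*-monoʳ-≤ P (ℕP.+-monoʳ-≤ (m * c) (Σ<-≤-period t≤P)) ⟩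
        P * (m * c + c)                ≤⟨ ℕP.m≤m+n (P * (m * c + c)) (t * c) ⟩
        P * (m * c + c) + t * c        ≡⟨ regroup c m P t ⟩
        (m * P + t) * c + P * c        ∎
        where
          open ℕP.≤-Reasoning
          regroup : ∀ c m P t → P * (m * c + c) + t * c ≡ (m * P + t) * c + P * c
          regroup = ℕ-solve-∀

  Σ<-translate : ∀ a → Σ< P (λ i → h (a + i)) ≡ Σ< P h
  Σ<-translate zero    = refl
  Σ<-translate (suc a) = begin
    Σ< P (λ i → h (suc a + i))      ≡⟨ Σ<-cong P (λ i → cong h (sym (ℕP.+-suc a i))) ⟩
    Σ< P (λ i → g (suc i))          ≡⟨ ℕP.+-cancelˡ-≡ (g 0) _ _ rotate ⟩
    Σ< P g                          ≡⟨ Σ<-translate a ⟩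
    Σ< P h                          ∎
    where
      open ≡-Reasoning
      g : ℕ → ℕ
      g i = h (a + i)
      rotate : g 0 + Σ< P (λ i → g (suc i)) ≡ g 0 + Σ< P g
      rotate = begin
        Σ< (suc P) g                ≡⟨ cong (λ n → Σ< n g) (ℕP.+-comm 1 P) ⟩
        Σ< (P + 1) g                ≡⟨ Σ<-split P 1 g ⟩
        Σ< P g + (g (P + 0) + 0)    ≡⟨ cong (λ x → Σ< P g + x) (trans (ℕP.+-identityʳ _) (translate-periodic a 0)) ⟩
        Σ< P g + g 0                ≡⟨ ℕP.+-comm (Σ< P g) (g 0) ⟩
        g 0 + Σ< P g                ∎

Σ<-translated-bounds : ∀ (h : ℕ → ℕ) P .{{_ : NonZero P}} → (∀ i → h (P + i) ≡ h i) → ∀ a n →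
  (n * Σ< P h ≤ P * Σ< n (λ i → h (a + i)) + P * Σ< P h) ×
  (P * Σ< n (λ i → h (a + i)) ≤ n * Σ< P h + P * Σ< P h)
Σ<-translated-bounds h P periodic a n =
  subst (λ c → (n * c ≤ P * Σ< n g + P * c) × (P * Σ< n g ≤ n * c + P * c))
        (PeriodicSum.Σ<-translate h P periodic a)
        (PeriodicSum.Σ<-bounds g P (PeriodicSum.translate-periodic h P periodic a) n)
  where
    g : ℕ → ℕ
    g i = h (a + i)

indicator : Bool → ℕ
indicator b = if b then 1 else 0

sum-concatMap : ∀ {A : Set} (f : A → List ℕ) xs → sum (concatMap f xs) ≡ sum (map (λ x → sum (f x)) xs)
sum-concatMap f []       = refl
sum-concatMap f (x ∷ xs) = trans (sum-++ (f x) (concatMap f xs)) (cong (sum (f x) ℕ.+_) (sum-concatMap f xs))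

sum-map-applyUpTo : ∀ {A : Set} (g : A → ℕ) (φ : ℕ → A) n f →
                    sum (map g (map φ (applyUpTo f n))) ≡ Σ< n (λ i → g (φ (f i)))
sum-map-applyUpTo g φ zero    f = refl
sum-map-applyUpTo g φ (suc n) f = cong (g (φ (f 0)) ℕ.+_) (sum-map-applyUpTo g φ n (λ i → f (suc i)))

count≡Σ< : ∀ S x y k → count S (x , y) k ≡
  Σ< (suc (2 * k)) (λ i → Σ< (suc (2 * k)) (λ j → indicator (S (x ℤ.+ (+ i ℤ.- + k) , y ℤ.+ (+ j ℤ.- + k)))))
count≡Σ< S x y k = begin
  count S (x , y) k
    ≡⟨ sum-concatMap row (range k) ⟩
  sum (map (λ a → sum (row a)) (range k))
    ≡⟨ sum-map-applyUpTo (λ a → sum (row a)) (λ n → + n ℤ.- + k) (suc (2 * k)) (λ i → i) ⟩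
  Σ< (suc (2 * k)) (λ i → sum (row (+ i ℤ.- + k)))
    ≡⟨ Σ<-cong (suc (2 * k)) (λ i → sum-map-applyUpTo (λ b → indicator (S (x ℤ.+ (+ i ℤ.- + k) , y ℤ.+ b))) (λ n → + n ℤ.- + k) (suc (2 * k)) (λ j → j)) ⟩
  Σ< (suc (2 * k)) (λ i → Σ< (suc (2 * k)) (λ j → indicator (S (x ℤ.+ (+ i ℤ.- + k) , y ℤ.+ (+ j ℤ.- + k))))) ∎
  where
    open ≡-Reasoning
    row : ℤ → List ℕ
    row a = map (λ b → indicator (S (x ℤ.+ a , y ℤ.+ b))) (range k)

cellCount : ℕ → ℕ → ℕ
cellCount r j = indicator (tile r (j ℕ.% 4))

columnWeight : ℕ → ℕ
columnWeight r = Σ< 4 (cellCount r)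

stripWeight : ℕ → ℕ
stripWeight i = columnWeight (i ℕ.% 9)

cellCount-periodic : ∀ r j → cellCount r (4 + j) ≡ cellCount r j
cellCount-periodic r j = cong (λ n → indicator (tile r n)) (trans (cong (ℕ._% 4) (ℕP.+-comm 4 j)) ([m+n]%n≡m%n j 4))

stripWeight-periodic : ∀ i → stripWeight (9 + i) ≡ stripWeight i
stripWeight-periodic i = cong columnWeight (trans (cong (ℕ._% 9) (ℕP.+-comm 9 i)) ([m+n]%n≡m%n i 9))

private
  shift-base : ∀ (x k i : ℤ) → x ℤ.+ (i ℤ.- k) ≡ (x ℤ.- k) ℤ.+ i
  shift-base = ℤ-solve-∀

  shift-height : ∀ (y b j : ℤ) → (y ℤ.+ j) ℤ.- b ≡ (y ℤ.- b) ℤ.+ j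
  shift-height = ℤ-solve-∀

column-+ : ∀ x i → column (x ℤ.+ + i) ≡ (column x + i) ℕ.% 9
column-+ x i = proj₂ (divMod-+ x (+ i) 9)

stripTiling-up : ∀ s X Y j → indicator (stripTiling s (X , Y ℤ.+ + j)) ≡ cellCount (column X) (height s (X , Y) + j)
stripTiling-up s X Y j = cong (λ n → indicator (tile (column X) n))
  (trans (cong (_%ℕ 4) (shift-height Y (shift (s (strip X))) (+ j))) (proj₂ (divMod-+ (Y ℤ.- shift (s (strip X))) (+ j) 4)))

private
  combine-bounds : ∀ C A N → 1 ≤ N → 4 * C ≤ N * A + 4 * A → N * A ≤ 4 * C + 4 * A →
                   N * 8 ≤ 9 * A + 9 * 8 → 9 * A ≤ N * 8 + 9 * 8 →
                   (36 * C ≤ 8 * N * N + 392 * N) × (8 * N * N ≤ 36 * C + 392 * N)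
  combine-bounds C A N 1≤N 4C≤ AN≤ 8N≤ 9A≤ = upper , lower
    where
      288≤288N : 288 ≤ 288 * N
      288≤288N = subst (_≤ 288 * N) (ℕP.*-identityʳ 288) (ℕP.*-monoʳ-≤ 288 1≤N)
      upper : 36 * C ≤ 8 * N * N + 392 * N
      upper = begin
        36 * C                        ≡⟨ e₁ C ⟩
        9 * (4 * C)                   ≤⟨ ℕP.*-monoʳ-≤ 9 4C≤ ⟩
        9 * (N * A + 4 * A)           ≡⟨ e₂ A N ⟩
        (9 * A) * (N + 4)             ≤⟨ ℕP.*-monoˡ-≤ (N + 4) 9A≤ ⟩
        (N * 8 + 9 * 8) * (N + 4)     ≡⟨ e₃ N ⟩
        8 * N * N + 104 * N + 288     ≤⟨ ℕP.+-monoʳ-≤ (8 * N * N + 104 * N) 288≤288N ⟩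
        8 * N * N + 104 * N + 288 * N ≡⟨ e₄ N ⟩
        8 * N * N + 392 * N           ∎
        where
          open ℕP.≤-Reasoning
          e₁ : ∀ C → 36 * C ≡ 9 * (4 * C)
          e₁ = ℕ-solve-∀
          e₂ : ∀ A N → 9 * (N * A + 4 * A) ≡ (9 * A) * (N + 4)
          e₂ = ℕ-solve-∀
          e₃ : ∀ N → (N * 8 + 9 * 8) * (N + 4) ≡ 8 * N * N + 104 * N + 288
          e₃ = ℕ-solve-∀
          e₄ : ∀ N → 8 * N * N + 104 * N + 288 * N ≡ 8 * N * N + 392 * N
          e₄ = ℕ-solve-∀
      lower : 8 * N * N ≤ 36 * C + 392 * N
      lower = begin
        8 * N * N                              ≡⟨ f₀ N ⟩
        (N * 8) * N                            ≤⟨ ℕP.*-monoˡ-≤ N 8N≤ ⟩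
        (9 * A + 9 * 8) * N                    ≡⟨ f₁ A N ⟩
        9 * (N * A) + 72 * N                   ≤⟨ ℕP.+-monoˡ-≤ (72 * N) (ℕP.*-monoʳ-≤ 9 AN≤) ⟩
        9 * (4 * C + 4 * A) + 72 * N           ≡⟨ f₂ C A N ⟩
        36 * C + 4 * (9 * A) + 72 * N          ≤⟨ ℕP.+-monoˡ-≤ (72 * N) (ℕP.+-monoʳ-≤ (36 * C) (ℕP.*-monoʳ-≤ 4 9A≤)) ⟩
        36 * C + 4 * (N * 8 + 9 * 8) + 72 * N  ≡⟨ f₃ C N ⟩
        36 * C + 104 * N + 288                 ≤⟨ ℕP.+-monoʳ-≤ (36 * C + 104 * N) 288≤288N ⟩
        36 * C + 104 * N + 288 * N             ≡⟨ f₄ C N ⟩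
        36 * C + 392 * N                       ∎
        where
          open ℕP.≤-Reasoning
          f₀ : ∀ N → 8 * N * N ≡ (N * 8) * N
          f₀ = ℕ-solve-∀
          f₁ : ∀ A N → (9 * A + 9 * 8) * N ≡ 9 * (N * A) + 72 * N
          f₁ = ℕ-solve-∀
          f₂ : ∀ C A N → 9 * (4 * C + 4 * A) + 72 * N ≡ 36 * C + 4 * (9 * A) + 72 * N
          f₂ = ℕ-solve-∀
          f₃ : ∀ C N → 36 * C + 4 * (N * 8 + 9 * 8) + 72 * N ≡ 36 * C + 104 * N + 288
          f₃ = ℕ-solve-∀
          f₄ : ∀ C N → 36 * C + 104 * N + 288 * N ≡ 36 * C + 392 * N
          f₄ = ℕ-solve-∀

  Σ<-scaled-≤ : ∀ n (a b c : ℕ → ℕ) (α β γ : ℕ) → (∀ i → α * a i ≤ β * b i + γ * c i) →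
                α * Σ< n a ≤ β * Σ< n b + γ * Σ< n c
  Σ<-scaled-≤ n a b c α β γ le = begin
    α * Σ< n a                                   ≡⟨ sym (Σ<-*ˡ n α a) ⟩
    Σ< n (λ i → α * a i)                         ≤⟨ Σ<-mono-≤ n le ⟩
    Σ< n (λ i → β * b i + γ * c i)               ≡⟨ Σ<-+ n _ _ ⟩
    Σ< n (λ i → β * b i) + Σ< n (λ i → γ * c i)  ≡⟨ cong₂ _+_ (Σ<-*ˡ n β b) (Σ<-*ˡ n γ c) ⟩
    β * Σ< n b + γ * Σ< n c                      ∎
    where open ℕP.≤-Reasoning

stripTiling-count-bounds : ∀ s x y k → let C = count (stripTiling s) (x , y) k ; N = suc (2 * k) in
                           (36 * C ≤ 8 * N * N + 392 * N) × (8 * N * N ≤ 36 * C + 392 * N)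
stripTiling-count-bounds s x y k =
  subst (λ C → (36 * C ≤ 8 * N * N + 392 * N) × (8 * N * N ≤ 36 * C + 392 * N)) (sym count≡)
    (combine-bounds (Σ< N W) (Σ< N c) N (s≤s z≤n)
      (Σ<-scaled-≤ N W c c 4 N 4 (λ i → proj₂ (column-bounds i)))
      (Σ<-scaled-≤ N c W c N 4 4 (λ i → proj₁ (column-bounds i)))
      (proj₁ strip-bounds) (proj₂ strip-bounds))
  where
    N  = suc (2 * k)
    x₀ = x ℤ.- + k
    y₀ = y ℤ.- + k
    X : ℕ → ℤ
    X i = x ℤ.+ (+ i ℤ.- + k)
    r : ℕ → ℕ
    r i = (column x₀ + i) ℕ.% 9
    W : ℕ → ℕ
    W i = Σ< N (λ j → cellCount (r i) (height s (X i , y₀) + j))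
    c : ℕ → ℕ
    c i = columnWeight (r i)

    column-X : ∀ i → column (X i) ≡ r i
    column-X i = trans (cong column (shift-base x (+ k) (+ i))) (column-+ x₀ i)

    cell : ∀ i j → indicator (stripTiling s (X i , y ℤ.+ (+ j ℤ.- + k))) ≡ cellCount (r i) (height s (X i , y₀) + j)
    cell i j = begin
      indicator (stripTiling s (X i , y ℤ.+ (+ j ℤ.- + k)))   ≡⟨ cong (λ b → indicator (stripTiling s (X i , b))) (shift-base y (+ k) (+ j)) ⟩
      indicator (stripTiling s (X i , y₀ ℤ.+ + j))            ≡⟨ stripTiling-up s (X i) y₀ j ⟩
      cellCount (column (X i)) (height s (X i , y₀) + j)      ≡⟨ cong (λ r → cellCount r (height s (X i , y₀) + j)) (column-X i) ⟩
      cellCount (r i) (height s (X i , y₀) + j)               ∎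
      where open ≡-Reasoning

    count≡ : count (stripTiling s) (x , y) k ≡ Σ< N W
    count≡ = trans (count≡Σ< (stripTiling s) x y k) (Σ<-cong N (λ i → Σ<-cong N (cell i)))

    column-bounds : ∀ i → (N * c i ≤ 4 * W i + 4 * c i) × (4 * W i ≤ N * c i + 4 * c i)
    column-bounds i = Σ<-translated-bounds (cellCount (r i)) 4 (cellCount-periodic (r i)) (height s (X i , y₀)) N

    strip-bounds : (N * 8 ≤ 9 * Σ< N c + 9 * 8) × (9 * Σ< N c ≤ N * 8 + 9 * 8)
    strip-bounds = Σ<-translated-bounds stripWeight 9 stripWeight-periodic (column x₀) N

private
  pos-2q+9p : ∀ q p n → + ((2 * q + p * 9) * n) ≡ (+ 2 ℤ.* + q ℤ.+ + p ℤ.* + 9) ℤ.* + n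
  pos-2q+9p q p n = trans (ℤP.pos-* (2 * q + p * 9) n)
    (cong (ℤ._* + n) (trans (ℤP.pos-+ (2 * q) (p * 9)) (cong₂ ℤ._+_ (ℤP.pos-* 2 q) (ℤP.pos-* p 9))))

  pos-2q-9p : ∀ q p n → + (2 * q * n) ℤ.- + (p * 9 * n) ≡ (+ 2 ℤ.* + q ℤ.+ (ℤ.- + p) ℤ.* + 9) ℤ.* + n
  pos-2q-9p q p n = begin
    + (2 * q * n) ℤ.- + (p * 9 * n)
      ≡⟨ cong₂ ℤ._-_ (trans (ℤP.pos-* (2 * q) n) (cong (ℤ._* + n) (ℤP.pos-* 2 q)))
                    (trans (ℤP.pos-* (p * 9) n) (cong (ℤ._* + n) (ℤP.pos-* p 9))) ⟩
    (+ 2 ℤ.* + q) ℤ.* + n ℤ.- (+ p ℤ.* + 9) ℤ.* + n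
      ≡⟨ distrib (+ 2) (+ q) (+ p) (+ n) ⟩
    (+ 2 ℤ.* + q ℤ.+ (ℤ.- + p) ℤ.* + 9) ℤ.* + n ∎
    where
      open ≡-Reasoning
      distrib : ∀ (a q p n : ℤ) → (a ℤ.* q) ℤ.* n ℤ.- (p ℤ.* + 9) ℤ.* n ≡ (a ℤ.* q ℤ.+ (ℤ.- p) ℤ.* + 9) ℤ.* n
      distrib = ℤ-solve-∀

  sub-≤ : ∀ a b c → a ≤ c + b → + a ℤ.- + b ℤ.≤ + c
  sub-≤ a b c h = subst (+ a ℤ.- + b ℤ.≤_) (cancel (+ c) (+ b))
    (ℤP.+-monoˡ-≤ (ℤ.- + b) (subst (+ a ℤ.≤_) (ℤP.pos-+ c b) (+≤+ h)))
    where
      cancel : ∀ (c b : ℤ) → (c ℤ.+ b) ℤ.- b ≡ c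
      cancel = ℤ-solve-∀

ratio≤2/9+ε : ∀ C n ε → Positive ε → C * (9 * ↧ₙ ε) ≤ (2 * ↧ₙ ε + ℤ.∣ ↥ ε ∣ * 9) * suc n →
              (+ C) / suc n ℚ.≤ (+ 2) / 9 ℚ.+ ε
ratio≤2/9+ε C n ε@(mkℚ (+ p) q _) _ h =
  toℚᵘ-cancel-≤ (ℚᵘP.≤-respʳ-≃ (ℚᵘP.≃-sym (toℚᵘ-homo-+ ((+ 2) / 9) ε))
                (ℚᵘP.≤-respˡ-≃ (ℚᵘP.≃-sym (toℚᵘ-fromℚᵘ (ℚᵘ.mkℚᵘ (+ C) n)))
                  (ℚᵘ.*≤* (subst₂ ℤ._≤_ (ℤP.pos-* C (9 * suc q)) (pos-2q+9p (suc q) p (suc n)) (+≤+ h)))))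

2/9-ε≤ratio : ∀ C n ε → Positive ε → 2 * ↧ₙ ε * suc n ≤ C * (9 * ↧ₙ ε) + ℤ.∣ ↥ ε ∣ * 9 * suc n →
              (+ 2) / 9 ℚ.- ε ℚ.≤ (+ C) / suc n
2/9-ε≤ratio C n ε@(mkℚ (+ suc p) q _) _ h =
  toℚᵘ-cancel-≤ (ℚᵘP.≤-respˡ-≃ (ℚᵘP.≃-sym (toℚᵘ-homo-+ ((+ 2) / 9) (ℚ.- ε)))
                (ℚᵘP.≤-respʳ-≃ (ℚᵘP.≃-sym (toℚᵘ-fromℚᵘ (ℚᵘ.mkℚᵘ (+ C) n)))
                  (ℚᵘ.*≤* (subst₂ ℤ._≤_ (pos-2q-9p (suc q) (suc p) (suc n)) (ℤP.pos-* C (9 * suc q)) (sub-≤ _ _ _ h)))))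

-- The error term 392 N of the count bounds is absorbed once N ≥ 11 Q, since 392 < 36 · 11.
errorTerm-≤ : ∀ N Q P → 11 * Q ≤ N → 1 ≤ P → 392 * N * Q ≤ 36 * P * N * N
errorTerm-≤ N Q P 11Q≤N 1≤P = begin
  392 * N * Q          ≤⟨ ℕP.*-monoˡ-≤ Q (ℕP.*-monoˡ-≤ N (ℕP.m≤m+n 392 4)) ⟩
  396 * N * Q          ≡⟨ e₁ N Q ⟩
  36 * N * (11 * Q)    ≤⟨ ℕP.*-monoʳ-≤ (36 * N) 11Q≤N ⟩
  36 * N * N           ≡⟨ e₂ N ⟩
  36 * 1 * N * N       ≤⟨ ℕP.*-monoˡ-≤ N (ℕP.*-monoˡ-≤ N (ℕP.*-monoʳ-≤ 36 1≤P)) ⟩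
  36 * P * N * N       ∎
  where
    open ℕP.≤-Reasoning
    e₁ : ∀ N Q → 396 * N * Q ≡ 36 * N * (11 * Q)
    e₁ = ℕ-solve-∀
    e₂ : ∀ N → 36 * N * N ≡ 36 * 1 * N * N
    e₂ = ℕ-solve-∀

count≤⇒ratio-hyp : ∀ C N Q P → 11 * Q ≤ N → 1 ≤ P → 36 * C ≤ 8 * N * N + 392 * N →
                   C * (9 * Q) ≤ (2 * Q + P * 9) * (N * N)
count≤⇒ratio-hyp C N Q P 11Q≤N 1≤P h = ℕP.*-cancelˡ-≤ 4 (begin
  4 * (C * (9 * Q))                           ≡⟨ e₁ C Q ⟩
  36 * C * Q                                  ≤⟨ ℕP.*-monoˡ-≤ Q h ⟩
  (8 * N * N + 392 * N) * Q                   ≡⟨ e₂ N Q ⟩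
  8 * N * N * Q + 392 * N * Q                 ≤⟨ ℕP.+-monoʳ-≤ (8 * N * N * Q) (errorTerm-≤ N Q P 11Q≤N 1≤P) ⟩
  8 * N * N * Q + 36 * P * N * N              ≡⟨ e₃ N Q P ⟩
  4 * ((2 * Q + P * 9) * (N * N))             ∎)
  where
    open ℕP.≤-Reasoning
    e₁ : ∀ C Q → 4 * (C * (9 * Q)) ≡ 36 * C * Q
    e₁ = ℕ-solve-∀
    e₂ : ∀ N Q → (8 * N * N + 392 * N) * Q ≡ 8 * N * N * Q + 392 * N * Q
    e₂ = ℕ-solve-∀
    e₃ : ∀ N Q P → 8 * N * N * Q + 36 * P * N * N ≡ 4 * ((2 * Q + P * 9) * (N * N))
    e₃ = ℕ-solve-∀

count≥⇒ratio-hyp : ∀ C N Q P → 11 * Q ≤ N → 1 ≤ P → 8 * N * N ≤ 36 * C + 392 * N →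
                   2 * Q * (N * N) ≤ C * (9 * Q) + P * 9 * (N * N)
count≥⇒ratio-hyp C N Q P 11Q≤N 1≤P h = ℕP.*-cancelˡ-≤ 4 (begin
  4 * (2 * Q * (N * N))                       ≡⟨ e₁ N Q ⟩
  8 * N * N * Q                               ≤⟨ ℕP.*-monoˡ-≤ Q h ⟩
  (36 * C + 392 * N) * Q                      ≡⟨ e₂ C N Q ⟩
  36 * C * Q + 392 * N * Q                    ≤⟨ ℕP.+-monoʳ-≤ (36 * C * Q) (errorTerm-≤ N Q P 11Q≤N 1≤P) ⟩
  36 * C * Q + 36 * P * N * N                 ≡⟨ e₃ C N Q P ⟩
  4 * (C * (9 * Q) + P * 9 * (N * N))         ∎)
  where
    open ℕP.≤-Reasoning
    e₁ : ∀ N Q → 4 * (2 * Q * (N * N)) ≡ 8 * N * N * Q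
    e₁ = ℕ-solve-∀
    e₂ : ∀ C N Q → (36 * C + 392 * N) * Q ≡ 36 * C * Q + 392 * N * Q
    e₂ = ℕ-solve-∀
    e₃ : ∀ C N Q P → 36 * C * Q + 36 * P * N * N ≡ 4 * (C * (9 * Q) + P * 9 * (N * N))
    e₃ = ℕ-solve-∀

private
  numerator≥1 : ∀ ε → Positive ε → 1 ≤ ∣ ↥ ε ∣
  numerator≥1 (mkℚ (+ suc _) _ _) _ = s≤s z≤n

  k≤2k+1 : ∀ k → k ≤ suc (2 * k)
  k≤2k+1 k = ℕP.≤-trans (ℕP.m≤m+n k (k + 0)) (ℕP.n≤1+n _)

stripTiling-density : ∀ s → HasDensity (stripTiling s) ((+ 2) / 9)
stripTiling-density s (x , y) = upper , lower
  where
    C : ℕ → ℕ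
    C k = count (stripTiling s) (x , y) k
    upper : ∀ ε → Positive ε → ∃[ K ] (∀ k → K ≤ k → ratio (stripTiling s) (x , y) k ℚ.≤ (+ 2) / 9 ℚ.+ ε)
    upper ε ε>0 = 11 * ↧ₙ ε , λ k K≤k →
      ratio≤2/9+ε (C k) (ℕ.pred (ballSize k)) ε ε>0
        (count≤⇒ratio-hyp (C k) (suc (2 * k)) (↧ₙ ε) ∣ ↥ ε ∣ (ℕP.≤-trans K≤k (k≤2k+1 k)) (numerator≥1 ε ε>0)
          (proj₁ (stripTiling-count-bounds s x y k)))
    lower : ∀ ε → Positive ε → ∀ K → ∃[ k ] ((K ≤ k) × ((+ 2) / 9 ℚ.- ε ℚ.≤ ratio (stripTiling s) (x , y) k))
    lower ε ε>0 K = k , ℕP.m≤m+n K _ ,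
      2/9-ε≤ratio (C k) (ℕ.pred (ballSize k)) ε ε>0
        (count≥⇒ratio-hyp (C k) (suc (2 * k)) (↧ₙ ε) ∣ ↥ ε ∣ (ℕP.≤-trans (ℕP.m≤n+m _ K) (k≤2k+1 k)) (numerator≥1 ε ε>0)
          (proj₂ (stripTiling-count-bounds s x y k)))
      where k = K + 11 * ↧ₙ ε

family : (ℕ → Bool) → VSet
family a = stripTiling (λ q → a ∣ q ∣)

family-at-strip : ∀ a n → family a (+ (n * 9) , + 0) ≡ not (a n)
family-at-strip a n = begin
  tile ((n * 9) ℕ.% 9) ((+ 0 ℤ.- shift (a ∣ + (n * 9 ℕ./ 9) ∣)) ℤ.%ℕ 4)
    ≡⟨ cong₂ (λ r q → tile r ((+ 0 ℤ.- shift (a q)) ℤ.%ℕ 4)) (m*n%n≡0 n 9) (m*n/n≡m n 9) ⟩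
  tile 0 ((+ 0 ℤ.- shift (a n)) ℤ.%ℕ 4)
    ≡⟨ corner (a n) ⟩
  not (a n) ∎
  where
    open ≡-Reasoning
    corner : ∀ b → tile 0 ((+ 0 ℤ.- shift b) ℤ.%ℕ 4) ≡ not b
    corner true  = refl
    corner false = refl

family-separates : ∀ a b n → a n ≢ b n → family a (+ (n * 9) , + 0) ≢ family b (+ (n * 9) , + 0)
family-separates a b n aₙ≢bₙ same =
  aₙ≢bₙ (not-injective (trans (sym (family-at-strip a n)) (trans same (family-at-strip b n))))

theorem5 : Σ ((ℕ → Bool) → VSet) λ F →
    (∀ (a : ℕ → Bool) → IsLPDS (F a) × HasDensity (F a) ((+ 2) / 9)) ×
    (∀ (a b : ℕ → Bool) → ∃[ n ] (a n ≢ b n) → ∃[ v ] (F a v ≢ F b v))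
theorem5 = family ,
  (λ a → stripTiling-isLPDS (λ q → a ∣ q ∣) , stripTiling-density (λ q → a ∣ q ∣)) ,
  λ a b (n , aₙ≢bₙ) → (+ (n * 9) , + 0) , family-separates a b n aₙ≢bₙ
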